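{- In classical propositional logic, for every formula $A$, writing $U(F)$ for the uniform post-interpolant of a formula $F$ with respect to ${\sf par}$, we have $\vdash U\big(U(A)\to A\big)\leftrightarrow\top$.
   Context: The language is built from atoms ${\sf var}\cup{\sf par}$ (variables and parameters, disjoint infinite sets) using $\bot,\wedge,\vee,\to$; $\top:=\bot\to\bot$. $\mathcal{L}({\sf par})$ is the set of formulas whose atoms are all parameters. $\vdash$ is classical derivability. The uniform post-interpolant $U(F)$ of $F$ w.r.t. ${\sf par}$ is the formula $B\in\mathcal{L}({\sf par})$ (unique up to equivalence) with $\vdash F\to B$ and $\vdash B\to C$ for every $C\in\mathcal{L}({\sf par})$ with $\vdash F\to C$. -}

module Defs where

open import Data.Nat using (ℕ)
open import Data.Product using (_×_)

infixr 6 _∧'_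
infixr 5 _∨'_
infixr 4 _⇒_ _⇔_

data Fm : Set where
  var  : ℕ → Fm
  par  : ℕ → Fm
  ⊥'   : Fm
  _∧'_ : Fm → Fm → Fm
  _∨'_ : Fm → Fm → Fm
  _⇒_  : Fm → Fm → Fm

⊤' : Fm
⊤' = ⊥' ⇒ ⊥'

_⇔_ : Fm → Fm → Fm
A ⇔ B = (A ⇒ B) ∧' (B ⇒ A)

data InPar : Fm → Set where
  par  : ∀ n → InPar (par n)
  ⊥'   : InPar ⊥'
  _∧'_ : ∀ {A B} → InPar A → InPar B → InPar (A ∧' B)
  _∨'_ : ∀ {A B} → InPar A → InPar B → InPar (A ∨' B)
  _⇒_  : ∀ {A B} → InPar A → InPar B → InPar (A ⇒ B)

infix 2 ⊢_
data ⊢_ : Fm → Set where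
  ax-K   : ∀ {A B}   → ⊢ A ⇒ (B ⇒ A)
  ax-S   : ∀ {A B C} → ⊢ (A ⇒ (B ⇒ C)) ⇒ ((A ⇒ B) ⇒ (A ⇒ C))
  ax-∧E₁ : ∀ {A B}   → ⊢ (A ∧' B) ⇒ A
  ax-∧E₂ : ∀ {A B}   → ⊢ (A ∧' B) ⇒ B
  ax-∧I  : ∀ {A B}   → ⊢ A ⇒ (B ⇒ (A ∧' B))
  ax-∨I₁ : ∀ {A B}   → ⊢ A ⇒ (A ∨' B)
  ax-∨I₂ : ∀ {A B}   → ⊢ B ⇒ (A ∨' B)
  ax-∨E  : ∀ {A B C} → ⊢ (A ⇒ C) ⇒ ((B ⇒ C) ⇒ ((A ∨' B) ⇒ C))
  ax-EFQ : ∀ {A}     → ⊢ ⊥' ⇒ A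
  ax-DNE : ∀ {A}     → ⊢ ((A ⇒ ⊥') ⇒ ⊥') ⇒ A
  mp     : ∀ {A B}   → ⊢ A ⇒ B → ⊢ A → ⊢ B

IsUPI : Fm → Fm → Set
IsUPI F B = InPar B × (⊢ F ⇒ B) × (∀ C → InPar C → ⊢ F ⇒ C → ⊢ B ⇒ C)

-- Let U = U(A) and U' = U(U → A). Since A implies U → A, monotonicity of
-- uniform post-interpolants gives U ⊢ U'. On the other hand ¬U ⊢ U → A ⊢ U'.
-- Reasoning by cases on U, the formula U' is a theorem, hence equivalent to ⊤.
module Submission where

open import Defs
open import Data.Product using (_,_)

⇒-refl : ∀ {A} → ⊢ A ⇒ A
⇒-refl {A} = mp (mp (ax-S {A} {A ⇒ A} {A}) ax-K) ax-K

⇒-const : ∀ {A B} → ⊢ B → ⊢ A ⇒ B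
⇒-const = mp ax-K

⇒-mp : ∀ {A B C} → ⊢ A ⇒ (B ⇒ C) → ⊢ A ⇒ B → ⊢ A ⇒ C
⇒-mp f g = mp (mp ax-S f) g

⇒-trans : ∀ {A B C} → ⊢ A ⇒ B → ⊢ B ⇒ C → ⊢ A ⇒ C
⇒-trans f g = ⇒-mp (⇒-const g) f

⇒-compose : ∀ {A B C} → ⊢ (B ⇒ C) ⇒ ((A ⇒ B) ⇒ (A ⇒ C))
⇒-compose = ⇒-mp (⇒-const ax-S) ax-K

¬-⇒ : ∀ {A B} → ⊢ (A ⇒ ⊥') ⇒ (A ⇒ B)
¬-⇒ = mp ⇒-compose ax-EFQ

contrapose : ∀ {A B} → ⊢ A ⇒ B → ⊢ (B ⇒ ⊥') ⇒ (A ⇒ ⊥')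
contrapose f = ⇒-mp ⇒-compose (⇒-const f)

by-cases : ∀ {A B} → ⊢ A ⇒ B → ⊢ (A ⇒ ⊥') ⇒ B → ⊢ B
by-cases A⇒B ¬A⇒B = mp ax-DNE (⇒-mp ⇒-refl (⇒-trans (contrapose A⇒B) ¬A⇒B))

⇔⊤-intro : ∀ {A} → ⊢ A → ⊢ A ⇔ ⊤'
⇔⊤-intro a = mp (mp ax-∧I (⇒-const ⇒-refl)) (⇒-const a)

IsUPI-mono : ∀ {F G B B'} → ⊢ F ⇒ G → IsUPI F B → IsUPI G B' → ⊢ B ⇒ B'
IsUPI-mono F⇒G (_ , _ , B-least) (B'-par , G⇒B' , _) =
  B-least _ B'-par (⇒-trans F⇒G G⇒B')

lemma3p4 : ∀ (A UA U' : Fm) → IsUPI A UA → IsUPI (UA ⇒ A) U'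
    → ⊢ U' ⇔ ⊤'
lemma3p4 A UA U' UA-upi U'-upi@(_ , [UA⇒A]⇒U' , _) =
  ⇔⊤-intro (by-cases UA⇒U' ¬UA⇒U')
  where
  UA⇒U' : ⊢ UA ⇒ U'
  UA⇒U' = IsUPI-mono ax-K UA-upi U'-upi

  ¬UA⇒U' : ⊢ (UA ⇒ ⊥') ⇒ U'
  ¬UA⇒U' = ⇒-trans ¬-⇒ [UA⇒A]⇒U'
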